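{- Let $G=(V,E)$ be a graph without isolated vertices and $k$ a positive integer. Then there is a sequence of at most $k$ inclusive vertex splits transforming $G$ into a constellation if and only if there is a Star-decomposition $\mathcal{P}$ of $G$ with $\mathrm{wgt}(\mathcal{P})\le |V(G)|+k$.
   Context: All graphs are finite, simple and undirected. An inclusive vertex split of a vertex $v$ removes $v$ and adds two new vertices $v_1,v_2$ with $N(v_1)\cup N(v_2)=N(v)$ ($N(v_1)$ and $N(v_2)$ may intersect); no other adjacencies change. A star is a graph with a single central vertex adjacent to all other vertices; a constellation is a disjoint union of stars. A Star-decomposition of $G$ is a set $\mathcal{P}=\{H_1,\dots,H_l\}$ of subgraphs of $G$, each isomorphic to a star, whose edge sets partition $E(G)$; its weight is $\mathrm{wgt}(\mathcal{P})=\sum_{v\in V}|\{i: v\in V(H_i)\}|$. -}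

module Defs where

open import Data.Nat using (ℕ; zero; suc; _+_; _≤_)
open import Data.Bool using (Bool; true; false; _∧_; _∨_; if_then_else_)
open import Data.Fin using (Fin)
open import Data.Fin.Subset using (Subset; _∈_; _∉_; ∣_∣; Nonempty)
open import Data.Vec using (lookup)
open import Data.List using (List; map)
open import Data.Nat.ListAction using (sum)
open import Data.List.Relation.Unary.All using (All)
open import Data.Product using (Σ; ∃; _×_; _,_)
open import Data.Sum using (_⊎_)
open import Relation.Binary.PropositionalEquality using (_≡_; _≢_)
open import Relation.Nullary using (¬_)

record Graph : Set where
  field
    size   : ℕ
    adj    : Fin size → Fin size → Bool
    sym    : ∀ x y → adj x y ≡ adj y x
    irrefl : ∀ x → adj x x ≡ false
open Graph public

Edge : (G : Graph) → Fin (size G) → Fin (size G) → Set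
Edge G x y = adj G x y ≡ true

NoIsolated : Graph → Set
NoIsolated G = ∀ v → ∃ λ u → Edge G v u

-- H arises from G by one inclusive vertex split (up to relabelling of vertices).
-- f : V(H) → V(G) maps v₁,v₂ to the split vertex v and is a bijection
-- V(H) ∖ {v₁,v₂} → V(G) ∖ {v} preserving and reflecting adjacency; moreover
-- N(v₁) ∪ N(v₂) = N(v) (via f) and v₁,v₂ are non-adjacent.
record InclusiveSplit (G H : Graph) : Set where
  field
    v      : Fin (size G)
    f      : Fin (size H) → Fin (size G)
    v₁ v₂  : Fin (size H)
    v₁≢v₂  : v₁ ≢ v₂
    f-v₁   : f v₁ ≡ v
    f-v₂   : f v₂ ≡ v
    fib-v  : ∀ x → f x ≡ v → x ≡ v₁ ⊎ x ≡ v₂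
    surj   : ∀ u → ∃ λ x → f x ≡ u
    inj    : ∀ x y → f x ≢ v → f x ≡ f y → x ≡ y
    adj-old : ∀ x y → f x ≢ v → f y ≢ v → adj H x y ≡ adj G (f x) (f y)
    adj-new : ∀ y → f y ≢ v → (adj H v₁ y ∨ adj H v₂ y) ≡ adj G v (f y)
    v₁v₂   : adj H v₁ v₂ ≡ false

data SplitSeq : Graph → Graph → ℕ → Set where
  done : ∀ {G} → SplitSeq G G 0
  step : ∀ {G H K j} → InclusiveSplit G H → SplitSeq H K j → SplitSeq G K (suc j)

-- Each vertex x is assigned the
-- centre c x of its component (c idempotent); two vertices are adjacent iff
-- they are distinct, in the same component, and one of them is the centre.
IsConstellation : Graph → Set
IsConstellation G =
  Σ (Fin (size G) → Fin (size G)) λ c →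
    (∀ x → c (c x) ≡ c x) ×
    (∀ x y → (Edge G x y → (x ≢ y × c x ≡ c y × (x ≡ c x ⊎ y ≡ c y))) ×
             ((x ≢ y × c x ≡ c y × (x ≡ c x ⊎ y ≡ c y)) → Edge G x y))

record StarSub (G : Graph) : Set where
  field
    centre   : Fin (size G)
    leaves   : Subset (size G)
    nonempty : Nonempty leaves
    centre∉  : centre ∉ leaves
    leafAdj  : ∀ y → y ∈ leaves → Edge G centre y
open StarSub public

open import Data.Fin using (_≟_)
open import Relation.Nullary.Decidable using (⌊_⌋)

containsEdge : ∀ {G} → StarSub G → Fin (size G) → Fin (size G) → Bool
containsEdge S x y =
  (⌊ centre S ≟ x ⌋ ∧ lookup (leaves S) y) ∨ (⌊ centre S ≟ y ⌋ ∧ lookup (leaves S) x)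

countContaining : ∀ {G} → List (StarSub G) → Fin (size G) → Fin (size G) → ℕ
countContaining 𝒫 x y = sum (map (λ S → if containsEdge S x y then 1 else 0) 𝒫)

-- Star-decomposition: the edge sets of the stars partition E(G)
-- (star edges are edges of G by leafAdj; every edge lies in exactly one star).
IsStarDecomposition : (G : Graph) → List (StarSub G) → Set
IsStarDecomposition G 𝒫 = ∀ x y → Edge G x y → countContaining 𝒫 x y ≡ 1

-- weight = Σ_i |V(H_i)| = Σ_i (1 + number of leaves)
wgt : ∀ {G} → List (StarSub G) → ℕ
wgt 𝒫 = sum (map (λ S → suc ∣ leaves S ∣) 𝒫)

{-# OPTIONS --safe #-}

-- (⇒) An inclusive split G ⇝ H comes with a map V(H) → V(G) along which every
-- edge of G lifts to an edge of H, so pushing the stars of a star cover of H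
-- forward gives a star cover of G of no larger weight. The components of the
-- constellation at the end of the sequence form a star cover of weight at most
-- its number of vertices, i.e. at most |V(G)| + k, and deleting from each star
-- the edges covered by later stars turns a star cover into a star decomposition
-- without increasing the weight.
--
-- (⇐) Without isolated vertices every vertex lies in a star of a decomposition,
-- so |V| ≤ wgt. If every vertex lies in exactly one star, the stars are the
-- components of a constellation. Otherwise some v lies in two stars S and T;
-- splitting v into a copy carrying the edges of S at v and one carrying the
-- rest yields a decomposition of the same weight of a graph with one more
-- vertex, so after at most wgt − |V| ≤ k splits a constellation is reached.

module Submission where

open import Defs hiding (sym)
open import Data.Nat using (ℕ; zero; suc; _+_; _≤_; _<_; NonZero; z≤n; s≤s)
open import Data.Nat.Properties
  using ( ≰⇒>; _≤?_; module ≤-Reasoning; ≤-refl; ≤-trans; ≤-reflexive; ≤-pred; 1+n≰n; m≤n+m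
        ; +-mono-≤; +-monoʳ-≤; +-monoˡ-≤; +-comm; +-assoc; +-suc; +-identityʳ)
open import Data.Nat.ListAction using (sum)
open import Data.Nat.ListAction.Properties using (sum-++)
open import Algebra.Properties.CommutativeMonoid.Sum Data.Nat.Properties.+-0-commutativeMonoid
  using (∑-comm; ∑-distrib-+; sum-cong-≗) renaming (sum to ∑)
open import Data.Bool using (Bool; true; false; _∧_; _∨_; not; if_then_else_)
open import Data.Bool.Properties
  using (∨-comm; ∨-zeroʳ; ∨-identityʳ; ∧-zeroʳ; ∧-identityʳ; ∧-conicalˡ; ∧-conicalʳ)
open import Data.Fin using (Fin; zero; suc; _≟_)
open import Data.Fin.Properties using (suc-injective; injective⇒≤; all?; ¬∀⟶∃¬)
open import Data.Fin.Subset using (Subset; _∈_; _∉_; ∣_∣; Nonempty; ⊥; ⁅_⁆; _∪_; _∩_; _-_)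
open import Data.Fin.Subset.Properties
  using ( nonempty?; ∉⊥; x∈⁅x⁆; x∈⁅y⁆⇒x≡y; x∈p∪q⁺; x∈p∪q⁻; x∈p∩q⁺; x∈p∩q⁻; p─q⊆p; x∈p∧x≢y⇒x∈p-y
        ; p⊆q⇒∣p∣≤∣q∣; ∣p∣≤∣x∷p∣; ∣⊥∣≡0; ∣⁅x⁆∣≡1; ∣p∩q∣≤∣p∣; x∈p⇒∣p-x∣<∣p∣)
open import Data.Vec using ([]; _∷_; lookup; tabulate; here; there)
open import Data.Vec.Properties using (lookup∘tabulate; []=⇒lookup; lookup⇒[]=)
open import Data.List using (List; []; _∷_; _++_; map; concat; concatMap)
import Data.List as List
open import Data.List.Properties using (map-++)
open import Data.List.Relation.Unary.Any.Properties using (map⁺; concat⁺; tabulate⁺)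
open import Data.List.Membership.Propositional using (find; lose) renaming (_∈_ to _∈ₗ_)
open import Data.List.Membership.Propositional.Properties using (∈-++⁺ˡ; ∈-++⁺ʳ; ∈-++⁻)
open import Data.List.Relation.Unary.Any as Any using (Any; here; there)
open import Data.Product using (Σ; ∃; ∃₂; _×_; _,_; proj₁; proj₂)
open import Data.Sum using (_⊎_; inj₁; inj₂)
open import Data.Empty using (⊥-elim)
open import Function using (_∘_; _⇔_; mk⇔)
open import Relation.Binary.PropositionalEquality
open import Relation.Nullary using (¬_; yes; no)
open import Relation.Nullary.Decidable using (⌊_⌋; ⌊⌋-map′)

indicator : Bool → ℕ
indicator b = if b then 1 else 0

∨-introˡ : ∀ {a} b → a ≡ true → a ∨ b ≡ true
∨-introˡ b refl = refl

∨-introʳ : ∀ a {b} → b ≡ true → a ∨ b ≡ true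
∨-introʳ a refl = ∨-zeroʳ a

∨-elim : ∀ a {b} → a ∨ b ≡ true → a ≡ true ⊎ b ≡ true
∨-elim true  _ = inj₁ refl
∨-elim false p = inj₂ p

⇔⇒≡ : ∀ {a b} → (a ≡ true → b ≡ true) → (b ≡ true → a ≡ true) → a ≡ b
⇔⇒≡ {false} {false} _   _   = refl
⇔⇒≡ {false} {true}  _   b⇒a = b⇒a refl
⇔⇒≡ {true}  {false} a⇒b _   = sym (a⇒b refl)
⇔⇒≡ {true}  {true}  _   _   = refl

indicator-∧-not : ∀ a b → indicator (a ∧ not b) + indicator b ≡ indicator (a ∨ b)
indicator-∧-not false false = refl
indicator-∧-not false true  = refl
indicator-∧-not true  false = refl
indicator-∧-not true  true  = refl

indicator-∨ : ∀ a b → indicator (a ∨ b) ≤ indicator a + indicator b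
indicator-∨ false b = ≤-refl
indicator-∨ true  b = s≤s z≤n

≟-complete : ∀ {n} {x y : Fin n} → x ≡ y → ⌊ x ≟ y ⌋ ≡ true
≟-complete {x = x} {y} x≡y with x ≟ y
... | yes _   = refl
... | no x≢y = ⊥-elim (x≢y x≡y)

≟-refl : ∀ {n} (x : Fin n) → ⌊ x ≟ x ⌋ ≡ true
≟-refl x = ≟-complete refl

≟-≢ : ∀ {n} {x y : Fin n} → x ≢ y → ⌊ x ≟ y ⌋ ≡ false
≟-≢ {x = x} {y} x≢y with x ≟ y
... | yes x≡y = ⊥-elim (x≢y x≡y)
... | no _    = refl

≟-sound : ∀ {n} {x y : Fin n} → ⌊ x ≟ y ⌋ ≡ true → x ≡ y
≟-sound {x = x} {y} p with x ≟ y
... | yes x≡y = x≡y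

∑-mono-≤ : ∀ {n} {f g : Fin n → ℕ} → (∀ i → f i ≤ g i) → ∑ f ≤ ∑ g
∑-mono-≤ {zero}  _   = z≤n
∑-mono-≤ {suc n} f≤g = +-mono-≤ (f≤g zero) (∑-mono-≤ (f≤g ∘ suc))

∑-const-1 : ∀ n → ∑ {n} (λ _ → 1) ≡ n
∑-const-1 zero    = refl
∑-const-1 (suc n) = cong suc (∑-const-1 n)

∑-const-0 : ∀ n → ∑ {n} (λ _ → 0) ≡ 0
∑-const-0 zero    = refl
∑-const-0 (suc n) = ∑-const-0 n

∑-indicator-≟ : ∀ {n} (x : Fin n) → ∑ (λ z → indicator ⌊ x ≟ z ⌋) ≡ 1
∑-indicator-≟ {suc n} zero    = cong suc (∑-const-0 n)
∑-indicator-≟ {suc n} (suc x) =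
  trans (sum-cong-≗ (λ z → cong indicator (⌊⌋-map′ (cong suc) suc-injective (x ≟ z))))
        (∑-indicator-≟ x)

∣p∣≡∑ : ∀ {n} (p : Subset n) → ∣ p ∣ ≡ ∑ (indicator ∘ lookup p)
∣p∣≡∑ []          = refl
∣p∣≡∑ (true ∷ p)  = cong suc (∣p∣≡∑ p)
∣p∣≡∑ (false ∷ p) = ∣p∣≡∑ p

∈-tabulate⁺ : ∀ {n} {f : Fin n → Bool} {x} → f x ≡ true → x ∈ tabulate f
∈-tabulate⁺ {f = f} {x} fx = lookup⇒[]= x (tabulate f) (trans (lookup∘tabulate f x) fx)

∈-tabulate⁻ : ∀ {n} {f : Fin n → Bool} {x} → x ∈ tabulate f → f x ≡ true
∈-tabulate⁻ {f = f} {x} x∈ = trans (sym (lookup∘tabulate f x)) ([]=⇒lookup x∈)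

x∉p-x : ∀ {n} (p : Subset n) x → x ∉ p - x
x∉p-x (_ ∷ p) zero    ()
x∉p-x (_ ∷ p) (suc x) (there x∈) = x∉p-x p x x∈

∣p∪q∣≤∣p∣+∣q∣ : ∀ {n} (p q : Subset n) → ∣ p ∪ q ∣ ≤ ∣ p ∣ + ∣ q ∣
∣p∪q∣≤∣p∣+∣q∣ []          []          = z≤n
∣p∪q∣≤∣p∣+∣q∣ (true ∷ p)  (s ∷ q)     =
  s≤s (≤-trans (∣p∪q∣≤∣p∣+∣q∣ p q) (+-monoʳ-≤ ∣ p ∣ (∣p∣≤∣x∷p∣ s q)))
∣p∪q∣≤∣p∣+∣q∣ (false ∷ p) (true ∷ q)  =
  ≤-trans (s≤s (∣p∪q∣≤∣p∣+∣q∣ p q)) (≤-reflexive (sym (+-suc ∣ p ∣ ∣ q ∣)))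
∣p∪q∣≤∣p∣+∣q∣ (false ∷ p) (false ∷ q) = ∣p∪q∣≤∣p∣+∣q∣ p q

image : ∀ {m n} → (Fin m → Fin n) → Subset m → Subset n
image f []          = ⊥
image f (true ∷ p)  = ⁅ f zero ⁆ ∪ image (f ∘ suc) p
image f (false ∷ p) = image (f ∘ suc) p

∈-image⁺ : ∀ {m n} (f : Fin m → Fin n) {p x} → x ∈ p → f x ∈ image f p
∈-image⁺ f {true ∷ p}  here       = x∈p∪q⁺ (inj₁ (x∈⁅x⁆ (f zero)))
∈-image⁺ f {true ∷ p}  (there x∈) = x∈p∪q⁺ (inj₂ (∈-image⁺ (f ∘ suc) x∈))
∈-image⁺ f {false ∷ p} (there x∈) = ∈-image⁺ (f ∘ suc) x∈

∈-image⁻ : ∀ {m n} (f : Fin m → Fin n) p {y} → y ∈ image f p → ∃ λ x → x ∈ p × f x ≡ y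
∈-image⁻ f []          y∈ = ⊥-elim (∉⊥ y∈)
∈-image⁻ f (true ∷ p)  y∈ with x∈p∪q⁻ ⁅ f zero ⁆ (image (f ∘ suc) p) y∈
... | inj₁ y∈⁅f0⁆ = zero , here , sym (x∈⁅y⁆⇒x≡y (f zero) y∈⁅f0⁆)
... | inj₂ y∈img  = let x , x∈ , fx≡y = ∈-image⁻ (f ∘ suc) p y∈img in suc x , there x∈ , fx≡y
∈-image⁻ f (false ∷ p) y∈ =
  let x , x∈ , fx≡y = ∈-image⁻ (f ∘ suc) p y∈ in suc x , there x∈ , fx≡y

∣image∣≤∣p∣ : ∀ {m n} (f : Fin m → Fin n) p → ∣ image f p ∣ ≤ ∣ p ∣
∣image∣≤∣p∣ {n = n} f []  = ≤-reflexive (∣⊥∣≡0 n)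
∣image∣≤∣p∣ f (true ∷ p)  = begin
  ∣ ⁅ f zero ⁆ ∪ q ∣     ≤⟨ ∣p∪q∣≤∣p∣+∣q∣ ⁅ f zero ⁆ q ⟩
  ∣ ⁅ f zero ⁆ ∣ + ∣ q ∣ ≡⟨ cong (_+ ∣ q ∣) (∣⁅x⁆∣≡1 (f zero)) ⟩
  suc ∣ q ∣             ≤⟨ s≤s (∣image∣≤∣p∣ (f ∘ suc) p) ⟩
  suc ∣ p ∣             ∎
  where
  open ≤-Reasoning
  q = image (f ∘ suc) p
∣image∣≤∣p∣ f (false ∷ p) = ∣image∣≤∣p∣ (f ∘ suc) p

tally : ∀ {A : Set} → (A → Bool) → List A → ℕ
tally p xs = sum (map (indicator ∘ p) xs)

module _ {A : Set} (p : A → Bool) where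

  Holds : A → Set
  Holds a = p a ≡ true

  tally-++ : ∀ xs ys → tally p (xs ++ ys) ≡ tally p xs + tally p ys
  tally-++ xs ys = trans (cong sum (map-++ (indicator ∘ p) xs ys)) (sum-++ (map (indicator ∘ p) xs) _)

  Any⇒1≤tally : ∀ {xs} → Any Holds xs → 1 ≤ tally p xs
  Any⇒1≤tally (here pa) rewrite pa = s≤s z≤n
  Any⇒1≤tally {a ∷ _} (there any) = ≤-trans (Any⇒1≤tally any) (m≤n+m _ (indicator (p a)))

  1≤tally⇒Any : ∀ xs → 1 ≤ tally p xs → Any Holds xs
  1≤tally⇒Any (a ∷ xs) 1≤ with p a in pa
  ... | true  = here pa
  ... | false = there (1≤tally⇒Any xs 1≤)

  2≤tally⇒split : ∀ xs → 2 ≤ tally p xs →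
    ∃₂ λ ys zs → ∃ λ a → xs ≡ ys ++ a ∷ zs × Holds a × Any Holds (ys ++ zs)
  2≤tally⇒split (a ∷ xs) 2≤ with p a in pa
  ... | true  = [] , xs , a , refl , pa , 1≤tally⇒Any xs (≤-pred 2≤)
  ... | false with 2≤tally⇒split xs 2≤
  ...   | ys , zs , b , refl , pb , any = a ∷ ys , zs , b , refl , pb , there any

  tally-middle : ∀ ys a zs → tally p (ys ++ a ∷ zs) ≡ indicator (p a) + tally p (ys ++ zs)
  tally-middle ys a zs = begin
    tally p (ys ++ a ∷ zs)                      ≡⟨ tally-++ ys (a ∷ zs) ⟩
    tally p ys + (indicator (p a) + tally p zs) ≡⟨ sym (+-assoc (tally p ys) _ _) ⟩
    tally p ys + indicator (p a) + tally p zs   ≡⟨ cong (_+ tally p zs) (+-comm (tally p ys) _) ⟩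
    indicator (p a) + tally p ys + tally p zs   ≡⟨ +-assoc (indicator (p a)) _ _ ⟩
    indicator (p a) + (tally p ys + tally p zs) ≡⟨ cong (indicator (p a) +_) (sym (tally-++ ys zs)) ⟩
    indicator (p a) + tally p (ys ++ zs)        ∎
    where open ≡-Reasoning

  tally≤1-exclusive : ∀ ys a zs → tally p (ys ++ a ∷ zs) ≤ 1 → Any Holds (ys ++ zs) → p a ≡ false
  tally≤1-exclusive ys a zs ≤1 any with p a in pa
  ... | false = refl
  ... | true  = ⊥-elim (1+n≰n (≤-trans (s≤s (Any⇒1≤tally any))
                                       (≤-trans (≤-reflexive (sym tally≡)) ≤1)))
    where
    tally≡ : tally p (ys ++ a ∷ zs) ≡ 1 + tally p (ys ++ zs)
    tally≡ = trans (tally-middle ys a zs) (cong (λ b → indicator b + tally p (ys ++ zs)) pa)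

  tally-concatMap : ∀ {B : Set} {q : B → Bool} (f : B → List A) xs →
    (∀ {b} → b ∈ₗ xs → tally p (f b) ≡ indicator (q b)) → tally p (concatMap f xs) ≡ tally q xs
  tally-concatMap f []       _    = refl
  tally-concatMap f (b ∷ xs) each =
    trans (tally-++ (f b) (concatMap f xs)) (cong₂ _+_ (each (here refl)) (tally-concatMap f xs (each ∘ there)))

  tally≤1-unique : ∀ {xs a b} → tally p xs ≤ 1 →
    a ∈ₗ xs → b ∈ₗ xs → Holds a → Holds b → a ≡ b
  tally≤1-unique _  (here refl) (here refl) _  _  = refl
  tally≤1-unique ≤1 (here refl) (there b∈) pa pb rewrite pa =
    ⊥-elim (1+n≰n (≤-trans (s≤s (Any⇒1≤tally (lose b∈ pb))) ≤1))
  tally≤1-unique ≤1 (there a∈) (here refl) pa pb rewrite pb =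
    ⊥-elim (1+n≰n (≤-trans (s≤s (Any⇒1≤tally (lose a∈ pa))) ≤1))
  tally≤1-unique {c ∷ _} ≤1 (there a∈) (there b∈) pa pb =
    tally≤1-unique (≤-trans (m≤n+m _ (indicator (p c))) ≤1) a∈ b∈ pa pb

spoke : ∀ {n} → Fin n → Subset n → Fin n → Fin n → Bool
spoke c L x y = (⌊ c ≟ x ⌋ ∧ lookup L y) ∨ (⌊ c ≟ y ⌋ ∧ lookup L x)

spoke-sym : ∀ {n} c (L : Subset n) x y → spoke c L x y ≡ spoke c L y x
spoke-sym c L x y = ∨-comm (⌊ c ≟ x ⌋ ∧ lookup L y) _

spoke⁺ : ∀ {n} c (L : Subset n) {x y} → c ≡ x → y ∈ L → spoke c L x y ≡ true
spoke⁺ c L refl y∈L rewrite ≟-refl c | []=⇒lookup y∈L = refl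

spoke⁻ : ∀ {n} c (L : Subset n) x y → spoke c L x y ≡ true → (c ≡ x × y ∈ L) ⊎ (c ≡ y × x ∈ L)
spoke⁻ c L x y sp with ∨-elim (⌊ c ≟ x ⌋ ∧ lookup L y) sp
... | inj₁ p = inj₁ (≟-sound (∧-conicalˡ _ _ p) , lookup⇒[]= y L (∧-conicalʳ ⌊ c ≟ x ⌋ _ p))
... | inj₂ p = inj₂ (≟-sound (∧-conicalˡ _ _ p) , lookup⇒[]= x L (∧-conicalʳ ⌊ c ≟ y ⌋ _ p))

IsStarCover : (G : Graph) → List (StarSub G) → Set
IsStarCover G 𝒫 = ∀ x y → Edge G x y → Any (λ S → containsEdge S x y ≡ true) 𝒫

decomposition⇒cover : ∀ {G 𝒫} → IsStarDecomposition G 𝒫 → IsStarCover G 𝒫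
decomposition⇒cover {𝒫 = 𝒫} dec x y e =
  1≤tally⇒Any (λ S → containsEdge S x y) 𝒫 (≤-reflexive (sym (dec x y e)))

module _ {G : Graph} where

  no-loop : ∀ {x} → ¬ Edge G x x
  no-loop {x} e with trans (sym e) (irrefl G x)
  ... | ()

  containsEdge⇒Edge : ∀ (S : StarSub G) {x y} → containsEdge S x y ≡ true → Edge G x y
  containsEdge⇒Edge S {x} {y} sp with spoke⁻ (centre S) (leaves S) x y sp
  ... | inj₁ (refl , y∈) = leafAdj S y y∈
  ... | inj₂ (refl , x∈) = trans (Graph.sym G x (centre S)) (leafAdj S x x∈)

  occurs : StarSub G → Fin (size G) → Bool
  occurs S x = ⌊ centre S ≟ x ⌋ ∨ lookup (leaves S) x

  containsEdge⇒occurs : ∀ (S : StarSub G) {x y} → containsEdge S x y ≡ true → occurs S x ≡ true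
  containsEdge⇒occurs S {x} {y} sp with spoke⁻ (centre S) (leaves S) x y sp
  ... | inj₁ (refl , _)  = ∨-introˡ _ (≟-refl x)
  ... | inj₂ (_ , x∈)    = ∨-introʳ _ ([]=⇒lookup x∈)

  occurs⇒containsEdge : ∀ (S : StarSub G) {x} → occurs S x ≡ true → ∃ λ y → containsEdge S x y ≡ true
  occurs⇒containsEdge S {x} occ with ∨-elim ⌊ centre S ≟ x ⌋ occ
  ... | inj₁ c≡x = let y , y∈ = nonempty S in y , spoke⁺ (centre S) (leaves S) (≟-sound c≡x) y∈
  ... | inj₂ x∈  = centre S , trans (spoke-sym (centre S) (leaves S) x _)
                                    (spoke⁺ (centre S) (leaves S) refl (lookup⇒[]= x (leaves S) x∈))

  starOf? : ∀ c L → (∀ y → y ∈ L → Edge G c y) → List (StarSub G)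
  starOf? c L adj with nonempty? L
  ... | yes ne = record { centre = c ; leaves = L ; nonempty = ne
                        ; centre∉ = no-loop ∘ adj c ; leafAdj = adj } ∷ []
  ... | no _   = []

  tally-starOf? : ∀ c L adj x y →
    tally (λ S → containsEdge S x y) (starOf? c L adj) ≡ indicator (spoke c L x y)
  tally-starOf? c L adj x y with nonempty? L
  ... | yes _  = +-identityʳ _
  ... | no ¬ne with spoke c L x y in sp
  ...   | false = refl
  ...   | true  with spoke⁻ c L x y sp
  ...     | inj₁ (_ , y∈) = ⊥-elim (¬ne (y , y∈))
  ...     | inj₂ (_ , x∈) = ⊥-elim (¬ne (x , x∈))

  starOf?-covers : ∀ c L adj {x y} → spoke c L x y ≡ true →
    Any (λ S → containsEdge S x y ≡ true) (starOf? c L adj)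
  starOf?-covers c L adj {x} {y} sp =
    1≤tally⇒Any _ _ (≤-reflexive (sym (trans (tally-starOf? c L adj x y) (cong indicator sp))))

  wgt-starOf? : ∀ c L adj {k} → (Nonempty L → suc ∣ L ∣ ≤ k) → wgt (starOf? c L adj) ≤ k
  wgt-starOf? c L adj bound with nonempty? L
  ... | yes ne = ≤-trans (≤-reflexive (+-identityʳ _)) (bound ne)
  ... | no _   = z≤n

  wgt-++ : ∀ (𝒫 𝒬 : List (StarSub G)) → wgt (𝒫 ++ 𝒬) ≡ wgt 𝒫 + wgt 𝒬
  wgt-++ 𝒫 𝒬 = trans (cong sum (map-++ _ 𝒫 𝒬)) (sum-++ (map (λ S → suc ∣ leaves S ∣) 𝒫) _)

wgt-concatMap : ∀ {G H : Graph} (f : StarSub G → List (StarSub H)) →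
  (∀ S → wgt (f S) ≤ suc ∣ leaves S ∣) → ∀ 𝒫 → wgt (concatMap f 𝒫) ≤ wgt 𝒫
wgt-concatMap f bound []      = z≤n
wgt-concatMap f bound (S ∷ 𝒫) =
  ≤-trans (≤-reflexive (wgt-++ (f S) (concatMap f 𝒫))) (+-mono-≤ (bound S) (wgt-concatMap f bound 𝒫))

-- From split sequences to star decompositions

module _ {G H : Graph} (φ : Fin (size G) → Fin (size H)) where

  -- Intersecting with the neighbourhood of the new centre makes push
  -- well defined for an arbitrary vertex map φ.
  pushLeaves : StarSub G → Subset (size H)
  pushLeaves T = image φ (leaves T) ∩ tabulate (adj H (φ (centre T)))

  pushLeaves-adj : ∀ T y → y ∈ pushLeaves T → Edge H (φ (centre T)) y
  pushLeaves-adj T y y∈ = ∈-tabulate⁻ (proj₂ (x∈p∩q⁻ (image φ (leaves T)) _ y∈))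

  push : StarSub G → List (StarSub H)
  push T = starOf? (φ (centre T)) (pushLeaves T) (pushLeaves-adj T)

  wgt-push : ∀ T → wgt (push T) ≤ suc ∣ leaves T ∣
  wgt-push T = wgt-starOf? (φ (centre T)) (pushLeaves T) (pushLeaves-adj T) λ _ →
    s≤s (≤-trans (∣p∩q∣≤∣p∣ (image φ (leaves T)) _) (∣image∣≤∣p∣ φ (leaves T)))

  push-spoke⁺ : ∀ T {u w} → containsEdge T u w ≡ true → Edge H (φ u) (φ w) →
    spoke (φ (centre T)) (pushLeaves T) (φ u) (φ w) ≡ true
  push-spoke⁺ T {u} {w} sp e with spoke⁻ (centre T) (leaves T) u w sp
  ... | inj₁ (refl , w∈) =
    spoke⁺ (φ (centre T)) (pushLeaves T) refl (x∈p∩q⁺ (∈-image⁺ φ w∈ , ∈-tabulate⁺ e))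
  ... | inj₂ (refl , u∈) = trans (spoke-sym (φ (centre T)) (pushLeaves T) (φ u) (φ w))
    (spoke⁺ (φ (centre T)) (pushLeaves T) refl
            (x∈p∩q⁺ (∈-image⁺ φ u∈ , ∈-tabulate⁺ (trans (Graph.sym H (φ w) (φ u)) e))))

  push-spoke⁻ : ∀ T {a b} → spoke (φ (centre T)) (pushLeaves T) a b ≡ true →
    ∃₂ λ u w → φ u ≡ a × φ w ≡ b × containsEdge T u w ≡ true
  push-spoke⁻ T {a} {b} sp with spoke⁻ (φ (centre T)) (pushLeaves T) a b sp
  ... | inj₁ (φc≡a , b∈) =
    let w , w∈ , φw≡b = ∈-image⁻ φ (leaves T) (proj₁ (x∈p∩q⁻ _ _ b∈))
    in centre T , w , φc≡a , φw≡b , spoke⁺ (centre T) (leaves T) refl w∈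
  ... | inj₂ (φc≡b , a∈) =
    let u , u∈ , φu≡a = ∈-image⁻ φ (leaves T) (proj₁ (x∈p∩q⁻ _ _ a∈))
    in u , centre T , φu≡a , φc≡b ,
       trans (spoke-sym (centre T) (leaves T) u _) (spoke⁺ (centre T) (leaves T) refl u∈)

  push-covers : ∀ T {u w} → containsEdge T u w ≡ true → Edge H (φ u) (φ w) →
    Any (λ S → containsEdge S (φ u) (φ w) ≡ true) (push T)
  push-covers T sp e = starOf?-covers (φ (centre T)) (pushLeaves T) (pushLeaves-adj T) (push-spoke⁺ T sp e)

  tally-push : (f : Fin (size H) → Fin (size G)) → (∀ u → f (φ u) ≡ u) →
    ∀ T {x y} → Edge H x y → (containsEdge T (f x) (f y) ≡ true → φ (f x) ≡ x × φ (f y) ≡ y) →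
    tally (λ S → containsEdge S x y) (push T) ≡ indicator (containsEdge T (f x) (f y))
  tally-push f f∘φ T {x} {y} e inRange =
    trans (tally-starOf? (φ (centre T)) (pushLeaves T) (pushLeaves-adj T) x y)
          (cong indicator (⇔⇒≡ pushed⇒original original⇒pushed))
    where
    pushed⇒original : spoke (φ (centre T)) (pushLeaves T) x y ≡ true → containsEdge T (f x) (f y) ≡ true
    pushed⇒original sp with push-spoke⁻ T sp
    ... | u , w , refl , refl , spT rewrite f∘φ u | f∘φ w = spT
    original⇒pushed : containsEdge T (f x) (f y) ≡ true → spoke (φ (centre T)) (pushLeaves T) x y ≡ true
    original⇒pushed spT with inRange spT
    ... | φfx≡x , φfy≡y =
      subst₂ (λ a b → spoke (φ (centre T)) (pushLeaves T) a b ≡ true) φfx≡x φfy≡y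
             (push-spoke⁺ T spT (subst₂ (Edge H) (sym φfx≡x) (sym φfy≡y) e))

EdgesLift : (H G : Graph) → (Fin (size H) → Fin (size G)) → Set
EdgesLift H G f = ∀ {a b} → Edge G a b → ∃₂ λ x y → f x ≡ a × f y ≡ b × Edge H x y

push-starCover : ∀ {H G} (f : Fin (size H) → Fin (size G)) → EdgesLift H G f →
  ∀ {𝒬} → IsStarCover H 𝒬 → IsStarCover G (concatMap (push f) 𝒬)
push-starCover f lift cover a b e with lift {a} {b} e
... | x , y , refl , refl , e′ =
  concat⁺ (map⁺ (Any.map (λ {T} spT → push-covers f T spT e) (cover x y e′)))

module _ {G : Graph} where

  coveredBy : List (StarSub G) → Fin (size G) → Fin (size G) → Bool
  coveredBy []      a b = false
  coveredBy (S ∷ 𝒫) a b = containsEdge S a b ∨ coveredBy 𝒫 a b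

  coveredBy-sym : ∀ 𝒫 a b → coveredBy 𝒫 a b ≡ coveredBy 𝒫 b a
  coveredBy-sym []      a b = refl
  coveredBy-sym (S ∷ 𝒫) a b = cong₂ _∨_ (spoke-sym (centre S) (leaves S) a b) (coveredBy-sym 𝒫 a b)

  Any⇒coveredBy : ∀ {𝒫 a b} → Any (λ S → containsEdge S a b ≡ true) 𝒫 → coveredBy 𝒫 a b ≡ true
  Any⇒coveredBy (here sp)                = ∨-introˡ _ sp
  Any⇒coveredBy {S ∷ _} {a} {b} (there any) = ∨-introʳ (containsEdge S a b) (Any⇒coveredBy any)

  trimLeaves : (Fin (size G) → Fin (size G) → Bool) → StarSub G → Subset (size G)
  trimLeaves seen S = tabulate (λ y → lookup (leaves S) y ∧ not (seen (centre S) y))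

  trimLeaves⊆ : ∀ seen S {y} → y ∈ trimLeaves seen S → y ∈ leaves S
  trimLeaves⊆ seen S {y} y∈ = lookup⇒[]= y (leaves S) (∧-conicalˡ _ _ (∈-tabulate⁻ y∈))

  trim : (Fin (size G) → Fin (size G) → Bool) → StarSub G → List (StarSub G)
  trim seen S = starOf? (centre S) (trimLeaves seen S) (λ y → leafAdj S y ∘ trimLeaves⊆ seen S)

  spoke-trim : ∀ seen → (∀ a b → seen a b ≡ seen b a) → ∀ S {a b} → a ≢ b →
    spoke (centre S) (trimLeaves seen S) a b ≡ containsEdge S a b ∧ not (seen a b)
  spoke-trim seen seen-sym S {a} {b} a≢b
    rewrite lookup∘tabulate (λ y → lookup (leaves S) y ∧ not (seen (centre S) y)) a
          | lookup∘tabulate (λ y → lookup (leaves S) y ∧ not (seen (centre S) y)) b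
    with centre S ≟ a | centre S ≟ b
  ... | yes refl | yes refl = ⊥-elim (a≢b refl)
  ... | yes refl | no _     = trans (∨-identityʳ (lookup (leaves S) b ∧ not (seen a b)))
                                    (cong (_∧ not (seen a b)) (sym (∨-identityʳ (lookup (leaves S) b))))
  ... | no _     | yes refl = cong (lookup (leaves S) a ∧_) (cong not (seen-sym b a))
  ... | no _     | no _     = refl

  dedup : List (StarSub G) → List (StarSub G)
  dedup []      = []
  dedup (S ∷ 𝒫) = trim (coveredBy 𝒫) S ++ dedup 𝒫

  tally-dedup : ∀ 𝒫 {a b} → a ≢ b →
    tally (λ S → containsEdge S a b) (dedup 𝒫) ≡ indicator (coveredBy 𝒫 a b)
  tally-dedup []      a≢b = refl
  tally-dedup (S ∷ 𝒫) {a} {b} a≢b = begin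
    tally (λ T → containsEdge T a b) (trim (coveredBy 𝒫) S ++ dedup 𝒫)
      ≡⟨ tally-++ _ (trim (coveredBy 𝒫) S) (dedup 𝒫) ⟩
    tally (λ T → containsEdge T a b) (trim (coveredBy 𝒫) S) + tally (λ T → containsEdge T a b) (dedup 𝒫)
      ≡⟨ cong₂ _+_ (trans (tally-starOf? (centre S) (trimLeaves (coveredBy 𝒫) S) _ a b)
                          (cong indicator (spoke-trim (coveredBy 𝒫) (coveredBy-sym 𝒫) S a≢b)))
                   (tally-dedup 𝒫 a≢b) ⟩
    indicator (containsEdge S a b ∧ not (coveredBy 𝒫 a b)) + indicator (coveredBy 𝒫 a b)
      ≡⟨ indicator-∧-not (containsEdge S a b) (coveredBy 𝒫 a b) ⟩
    indicator (coveredBy (S ∷ 𝒫) a b) ∎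
    where open ≡-Reasoning

  wgt-dedup : ∀ 𝒫 → wgt (dedup 𝒫) ≤ wgt 𝒫
  wgt-dedup []      = z≤n
  wgt-dedup (S ∷ 𝒫) = ≤-trans (≤-reflexive (wgt-++ (trim (coveredBy 𝒫) S) (dedup 𝒫)))
    (+-mono-≤ (wgt-starOf? (centre S) (trimLeaves (coveredBy 𝒫) S) _ λ _ →
                 s≤s (p⊆q⇒∣p∣≤∣q∣ (trimLeaves⊆ (coveredBy 𝒫) S)))
              (wgt-dedup 𝒫))

  starCover⇒decomposition : ∀ {𝒫} → IsStarCover G 𝒫 → IsStarDecomposition G (dedup 𝒫)
  starCover⇒decomposition {𝒫} cover a b e =
    trans (tally-dedup 𝒫 (λ a≡b → no-loop {G} (subst (Edge G a) (sym a≡b) e)))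
          (cong indicator (Any⇒coveredBy (cover a b e)))

fiber : ∀ {m n} → (Fin m → Fin n) → Fin n → Subset m
fiber c z = tabulate (λ y → ⌊ c y ≟ z ⌋)

∑-∣fiber∣ : ∀ {m n} (c : Fin m → Fin n) → ∑ (λ z → ∣ fiber c z ∣) ≡ m
∑-∣fiber∣ {m} {n} c = begin
  ∑ (λ z → ∣ fiber c z ∣)     ≡⟨ sum-cong-≗ ∣fiber∣≡∑ ⟩
  ∑ (λ z → ∑ (λ y → δ y z))   ≡⟨ ∑-comm (λ z y → δ y z) ⟩
  ∑ (λ y → ∑ (λ z → δ y z))   ≡⟨ sum-cong-≗ (∑-indicator-≟ ∘ c) ⟩
  ∑ {m} (λ _ → 1)             ≡⟨ ∑-const-1 m ⟩
  m                           ∎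
  where
  open ≡-Reasoning
  δ : Fin m → Fin n → ℕ
  δ y z = indicator ⌊ c y ≟ z ⌋
  ∣fiber∣≡∑ : ∀ z → ∣ fiber c z ∣ ≡ ∑ (λ y → δ y z)
  ∣fiber∣≡∑ z = trans (∣p∣≡∑ (fiber c z)) (sum-cong-≗ (cong indicator ∘ lookup∘tabulate (λ y → ⌊ c y ≟ z ⌋)))

wgt-concat-tabulate : ∀ {G m} (F : Fin m → List (StarSub G)) (g : Fin m → ℕ) →
  (∀ z → wgt (F z) ≤ g z) → wgt (concat (List.tabulate F)) ≤ ∑ g
wgt-concat-tabulate {m = zero}  F g bound = z≤n
wgt-concat-tabulate {m = suc m} F g bound =
  ≤-trans (≤-reflexive (wgt-++ (F zero) (concat (List.tabulate (F ∘ suc)))))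
          (+-mono-≤ (bound zero) (wgt-concat-tabulate (F ∘ suc) (g ∘ suc) (bound ∘ suc)))

module Constellation {K : Graph} (isC : IsConstellation K) where

  c : Fin (size K) → Fin (size K)
  c = proj₁ isC

  c-idem : ∀ x → c (c x) ≡ c x
  c-idem = proj₁ (proj₂ isC)

  satellites : Fin (size K) → Subset (size K)
  satellites z = fiber c z - z

  satellite⁺ : ∀ {y z} → y ≢ z → c y ≡ z → y ∈ satellites z
  satellite⁺ y≢z cy≡z = x∈p∧x≢y⇒x∈p-y (∈-tabulate⁺ (≟-complete cy≡z)) y≢z

  satellite⁻ : ∀ {y z} → y ∈ satellites z → y ≢ z × c y ≡ z
  satellite⁻ {y} {z} y∈ =
    (λ { refl → x∉p-x (fiber c y) y y∈ }) , ≟-sound (∈-tabulate⁻ (p─q⊆p (fiber c z) _ y∈))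

  satellite⇒centre : ∀ {y z} → y ∈ satellites z → c z ≡ z
  satellite⇒centre {y} y∈ with satellite⁻ y∈
  ... | _ , refl = c-idem y

  satellite-adj : ∀ z y → y ∈ satellites z → Edge K z y
  satellite-adj z y y∈ with satellite⁻ y∈
  ... | y≢z , refl =
    proj₂ (proj₂ (proj₂ isC) (c y) y) ((λ cy≡y → y≢z (sym cy≡y)) , c-idem y , inj₁ (sym (c-idem y)))

  star : Fin (size K) → List (StarSub K)
  star z = starOf? z (satellites z) (satellite-adj z)

  stars : List (StarSub K)
  stars = concat (List.tabulate star)

  edge⇒spoke : ∀ {x y} → Edge K x y → ∃ λ z → spoke z (satellites z) x y ≡ true
  edge⇒spoke {x} {y} e with proj₁ (proj₂ (proj₂ isC) x y) e
  ... | x≢y , cx≡cy , inj₁ x≡cx =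
    x , spoke⁺ x (satellites x) refl
              (satellite⁺ (λ y≡x → x≢y (sym y≡x)) (trans (sym cx≡cy) (sym x≡cx)))
  ... | x≢y , cx≡cy , inj₂ y≡cy =
    y , trans (spoke-sym y (satellites y) x y)
              (spoke⁺ y (satellites y) refl (satellite⁺ x≢y (trans cx≡cy (sym y≡cy))))

  stars-cover : IsStarCover K stars
  stars-cover x y e with edge⇒spoke e
  ... | z , sp = concat⁺ (tabulate⁺ z (starOf?-covers z (satellites z) (satellite-adj z) sp))

  wgt-stars : wgt stars ≤ size K
  wgt-stars = ≤-trans (wgt-concat-tabulate star (λ z → ∣ fiber c z ∣) wgt-star)
                      (≤-reflexive (∑-∣fiber∣ c))
    where
    wgt-star : ∀ z → wgt (star z) ≤ ∣ fiber c z ∣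
    wgt-star z = wgt-starOf? z (satellites z) (satellite-adj z) λ { (y , y∈) →
      x∈p⇒∣p-x∣<∣p∣ {p = fiber c z}
        (∈-tabulate⁺ {f = λ y → ⌊ c y ≟ z ⌋} (≟-complete (satellite⇒centre y∈))) }

constellation⇒starCover : ∀ {K} → IsConstellation K →
  Σ (List (StarSub K)) λ 𝒫 → IsStarCover K 𝒫 × wgt 𝒫 ≤ size K
constellation⇒starCover isC = stars , stars-cover , wgt-stars
  where open Constellation isC

module _ {G H : Graph} (split : InclusiveSplit G H) where
  open InclusiveSplit split

  lift-at-v : ∀ {b} → b ≢ v → Edge G v b → ∃₂ λ x y → f x ≡ v × f y ≡ b × Edge H x y
  lift-at-v {b} b≢v e with surj b
  ... | y , refl with ∨-elim (adj H v₁ y) (trans (adj-new y b≢v) e)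
  ...   | inj₁ e₁ = v₁ , y , f-v₁ , refl , e₁
  ...   | inj₂ e₂ = v₂ , y , f-v₂ , refl , e₂

  split-edgesLift : EdgesLift H G f
  split-edgesLift {a} {b} e with a ≟ v | b ≟ v
  ... | yes refl | yes refl = ⊥-elim (no-loop {G} e)
  ... | yes refl | no b≢v   = lift-at-v b≢v e
  ... | no a≢v   | yes refl with lift-at-v a≢v (trans (Graph.sym G v a) e)
  ...   | y , x , fy≡v , fx≡a , e′ = x , y , fx≡a , fy≡v , trans (Graph.sym H x y) e′
  split-edgesLift {a} {b} e | no a≢v | no b≢v with surj a | surj b
  ... | x , refl | y , refl = x , y , refl , refl , trans (adj-old x y a≢v b≢v) e

  -- f is injective away from v₂, so sending v₂ to the extra point gives an injection.
  split-size : size H ≤ suc (size G)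
  split-size = injective⇒≤ {f = code} code-injective
    where
    code : Fin (size H) → Fin (suc (size G))
    code x with x ≟ v₂
    ... | yes _ = zero
    ... | no _  = suc (f x)

    ≡v₁ : ∀ {x} → x ≢ v₂ → f x ≡ v → x ≡ v₁
    ≡v₁ {x} x≢v₂ fx≡v with fib-v x fx≡v
    ... | inj₁ x≡v₁ = x≡v₁
    ... | inj₂ x≡v₂ = ⊥-elim (x≢v₂ x≡v₂)

    code-injective : ∀ {x y} → code x ≡ code y → x ≡ y
    code-injective {x} {y} eq with x ≟ v₂ | y ≟ v₂
    ... | yes x≡v₂ | yes y≡v₂ = trans x≡v₂ (sym y≡v₂)
    ... | no x≢v₂  | no y≢v₂ with f x ≟ v | suc-injective eq
    ...   | no fx≢v  | fx≡fy = inj x y fx≢v fx≡fy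
    ...   | yes fx≡v | fx≡fy = trans (≡v₁ x≢v₂ fx≡v) (sym (≡v₁ y≢v₂ (trans (sym fx≡fy) fx≡v)))

splitSeq⇒starCover : ∀ {G K j} → SplitSeq G K j → IsConstellation K →
  Σ (List (StarSub G)) λ 𝒫 → IsStarCover G 𝒫 × wgt 𝒫 ≤ size G + j
splitSeq⇒starCover {G} done isC with constellation⇒starCover isC
... | 𝒫 , cover , w = 𝒫 , cover , ≤-trans w (≤-reflexive (sym (+-identityʳ (size G))))
splitSeq⇒starCover {G} (step {H = H} {j = j} split seq) isC with splitSeq⇒starCover seq isC
... | 𝒬 , cover , w = concatMap (push f) 𝒬 , push-starCover f (split-edgesLift split) cover , (begin
  wgt (concatMap (push f) 𝒬) ≤⟨ wgt-concatMap (push f) (wgt-push f) 𝒬 ⟩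
  wgt 𝒬                      ≤⟨ w ⟩
  size H + j                 ≤⟨ +-monoˡ-≤ j (split-size split) ⟩
  suc (size G) + j           ≡⟨ sym (+-suc (size G) j) ⟩
  size G + suc j             ∎)
  where
  open InclusiveSplit split
  open ≤-Reasoning

-- From star decompositions to split sequences

module _ {G : Graph} where

  multiplicity : List (StarSub G) → Fin (size G) → ℕ
  multiplicity 𝒫 x = tally (λ S → occurs S x) 𝒫

  ∑-indicator-occurs : ∀ (S : StarSub G) → ∑ (indicator ∘ occurs S) ≤ suc ∣ leaves S ∣
  ∑-indicator-occurs S = begin
    ∑ (indicator ∘ occurs S)
      ≤⟨ ∑-mono-≤ (λ x → indicator-∨ ⌊ centre S ≟ x ⌋ (lookup (leaves S) x)) ⟩
    ∑ (λ x → indicator ⌊ centre S ≟ x ⌋ + indicator (lookup (leaves S) x))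
      ≡⟨ ∑-distrib-+ (λ x → indicator ⌊ centre S ≟ x ⌋) (indicator ∘ lookup (leaves S)) ⟩
    ∑ (λ x → indicator ⌊ centre S ≟ x ⌋) + ∑ (indicator ∘ lookup (leaves S))
      ≡⟨ cong₂ _+_ (∑-indicator-≟ (centre S)) (sym (∣p∣≡∑ (leaves S))) ⟩
    1 + ∣ leaves S ∣ ∎
    where open ≤-Reasoning

  ∑-multiplicity≤wgt : ∀ 𝒫 → ∑ (multiplicity 𝒫) ≤ wgt 𝒫
  ∑-multiplicity≤wgt []      = ≤-reflexive (∑-const-0 (size G))
  ∑-multiplicity≤wgt (S ∷ 𝒫) =
    ≤-trans (≤-reflexive (∑-distrib-+ (indicator ∘ occurs S) (multiplicity 𝒫)))
            (+-mono-≤ (∑-indicator-occurs S) (∑-multiplicity≤wgt 𝒫))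

  size≤wgt : ∀ {𝒫} → (∀ x → Any (λ S → occurs S x ≡ true) 𝒫) → size G ≤ wgt 𝒫
  size≤wgt {𝒫} occ = begin
    size G               ≡⟨ sym (∑-const-1 (size G)) ⟩
    ∑ {size G} (λ _ → 1) ≤⟨ ∑-mono-≤ (λ x → Any⇒1≤tally (λ S → occurs S x) (occ x)) ⟩
    ∑ (multiplicity 𝒫)   ≤⟨ ∑-multiplicity≤wgt 𝒫 ⟩
    wgt 𝒫                ∎
    where open ≤-Reasoning

  decomposition-occurs : ∀ 𝒫 → NoIsolated G → IsStarDecomposition G 𝒫 →
    ∀ x → Any (λ S → occurs S x ≡ true) 𝒫
  decomposition-occurs 𝒫 noIsolated dec x with noIsolated x
  ... | u , e = Any.map (λ {S} → containsEdge⇒occurs S) (decomposition⇒cover dec x u e)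

module Disjoint {G : Graph} (𝒫 : List (StarSub G)) (dec : IsStarDecomposition G 𝒫)
  (occ : ∀ x → Any (λ S → occurs S x ≡ true) 𝒫) (≤1 : ∀ x → multiplicity 𝒫 x ≤ 1) where

  starAt : Fin (size G) → StarSub G
  starAt x = proj₁ (find (occ x))

  starAt∈ : ∀ x → starAt x ∈ₗ 𝒫
  starAt∈ x = proj₁ (proj₂ (find (occ x)))

  starAt-unique : ∀ {x T} → T ∈ₗ 𝒫 → occurs T x ≡ true → starAt x ≡ T
  starAt-unique {x} T∈ occT =
    tally≤1-unique (λ S → occurs S x) (≤1 x) (starAt∈ x) T∈ (proj₂ (proj₂ (find (occ x)))) occT

  c : Fin (size G) → Fin (size G)
  c x = centre (starAt x)

  c-idem : ∀ x → c (c x) ≡ c x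
  c-idem x = cong centre (starAt-unique (starAt∈ x) (∨-introˡ _ (≟-refl (c x))))

  edge⇒ : ∀ {x y} → Edge G x y → x ≢ y × c x ≡ c y × (x ≡ c x ⊎ y ≡ c y)
  edge⇒ {x} {y} e with find (decomposition⇒cover dec x y e)
  ... | T , T∈ , sp =
    (λ { refl → no-loop {G} e }) , trans cx≡ (sym cy≡) , centre-end (spoke⁻ (centre T) (leaves T) x y sp)
    where
    cx≡ : c x ≡ centre T
    cx≡ = cong centre (starAt-unique T∈ (containsEdge⇒occurs T sp))
    cy≡ : c y ≡ centre T
    cy≡ = cong centre (starAt-unique T∈
            (containsEdge⇒occurs T (trans (spoke-sym (centre T) (leaves T) y x) sp)))
    centre-end : (centre T ≡ x × y ∈ leaves T) ⊎ (centre T ≡ y × x ∈ leaves T) → x ≡ c x ⊎ y ≡ c y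
    centre-end (inj₁ (cT≡x , _)) = inj₁ (sym (trans cx≡ cT≡x))
    centre-end (inj₂ (cT≡y , _)) = inj₂ (sym (trans cy≡ cT≡y))

  centre-adj : ∀ {x y} → x ≢ y → c y ≡ x → Edge G x y
  centre-adj {x} {y} x≢y refl with ∨-elim ⌊ c y ≟ y ⌋ (proj₂ (proj₂ (find (occ y))))
  ... | inj₁ cy≡y = ⊥-elim (x≢y (≟-sound cy≡y))
  ... | inj₂ y∈   = leafAdj (starAt y) y (lookup⇒[]= y (leaves (starAt y)) y∈)

  ⇒edge : ∀ {x y} → x ≢ y × c x ≡ c y × (x ≡ c x ⊎ y ≡ c y) → Edge G x y
  ⇒edge {x} {y} (x≢y , cx≡cy , inj₁ x≡cx) = centre-adj x≢y (trans (sym cx≡cy) (sym x≡cx))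
  ⇒edge {x} {y} (x≢y , cx≡cy , inj₂ y≡cy) =
    trans (Graph.sym G x y) (centre-adj (λ y≡x → x≢y (sym y≡x)) (trans cx≡cy (sym y≡cy)))

  constellation : IsConstellation G
  constellation = c , c-idem , λ x y → edge⇒ , ⇒edge

-- In the split graph H, vertex zero
-- is the copy of v keeping the edges of S at v and suc v keeps the other edges
-- at v; S is relabelled along φ₁ and the other stars along suc.
module SplitAt {G : Graph} (A : List (StarSub G)) (S : StarSub G) (B : List (StarSub G))
  (v : Fin (size G)) (dec : IsStarDecomposition G (A ++ S ∷ B))
  (v∈S : occurs S v ≡ true) (v∈AB : Any (λ T → occurs T v ≡ true) (A ++ B)) where

  exclusive : ∀ {T a b} → T ∈ₗ A ++ B → containsEdge T a b ≡ true → containsEdge S a b ≡ false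
  exclusive {T} {a} {b} T∈ sp = tally≤1-exclusive (λ R → containsEdge R a b) A S B
    (≤-reflexive (dec a b (containsEdge⇒Edge T sp))) (lose T∈ sp)

  adjH : Fin (suc (size G)) → Fin (suc (size G)) → Bool
  adjH zero    zero    = false
  adjH zero    (suc u) = containsEdge S v u
  adjH (suc u) zero    = containsEdge S v u
  adjH (suc u) (suc w) = adj G u w ∧ not ((⌊ u ≟ v ⌋ ∨ ⌊ w ≟ v ⌋) ∧ containsEdge S u w)

  adjH-sym : ∀ x y → adjH x y ≡ adjH y x
  adjH-sym zero    zero    = refl
  adjH-sym zero    (suc u) = refl
  adjH-sym (suc u) zero    = refl
  adjH-sym (suc u) (suc w) = cong₂ _∧_ (Graph.sym G u w)
    (cong not (cong₂ _∧_ (∨-comm ⌊ u ≟ v ⌋ ⌊ w ≟ v ⌋) (spoke-sym (centre S) (leaves S) u w)))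

  adjH-irrefl : ∀ x → adjH x x ≡ false
  adjH-irrefl zero    = refl
  adjH-irrefl (suc u) rewrite irrefl G u = refl

  H : Graph
  H = record { size = suc (size G) ; adj = adjH ; sym = adjH-sym ; irrefl = adjH-irrefl }

  f : Fin (size H) → Fin (size G)
  f zero    = v
  f (suc u) = u

  split : InclusiveSplit G H
  split = record
    { v = v ; f = f ; v₁ = zero ; v₂ = suc v ; v₁≢v₂ = λ () ; f-v₁ = refl ; f-v₂ = refl
    ; fib-v = fib-v ; surj = λ u → suc u , refl ; inj = inj ; adj-old = adj-old ; adj-new = adj-new
    ; v₁v₂ = no-spoke-vv }
    where
    fib-v : ∀ x → f x ≡ v → x ≡ zero ⊎ x ≡ suc v
    fib-v zero    _    = inj₁ refl
    fib-v (suc u) u≡v = inj₂ (cong suc u≡v)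
    inj : ∀ x y → f x ≢ v → f x ≡ f y → x ≡ y
    inj zero    _       fx≢v _    = ⊥-elim (fx≢v refl)
    inj (suc u) zero    u≢v  u≡v  = ⊥-elim (u≢v u≡v)
    inj (suc u) (suc w) _    u≡w  = cong suc u≡w
    adj-old : ∀ x y → f x ≢ v → f y ≢ v → adjH x y ≡ adj G (f x) (f y)
    adj-old zero    _       v≢v _   = ⊥-elim (v≢v refl)
    adj-old (suc u) zero    _   v≢v = ⊥-elim (v≢v refl)
    adj-old (suc u) (suc w) u≢v w≢v rewrite ≟-≢ u≢v | ≟-≢ w≢v = ∧-identityʳ (adj G u w)
    adj-new : ∀ y → f y ≢ v → (adjH zero y ∨ adjH (suc v) y) ≡ adj G v (f y)
    adj-new zero    v≢v = ⊥-elim (v≢v refl)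
    adj-new (suc w) _   rewrite ≟-refl v with containsEdge S v w in sp
    ... | true  = sym (containsEdge⇒Edge S sp)
    ... | false = ∧-identityʳ (adj G v w)
    no-spoke-vv : containsEdge S v v ≡ false
    no-spoke-vv with containsEdge S v v in sp
    ... | true  = ⊥-elim (no-loop {G} (containsEdge⇒Edge S sp))
    ... | false = refl

  H-edge⇒G-edge : ∀ {x y} → Edge H x y → Edge G (f x) (f y)
  H-edge⇒G-edge {zero}  {suc w} e = containsEdge⇒Edge S e
  H-edge⇒G-edge {suc u} {zero}  e = trans (Graph.sym G u v) (containsEdge⇒Edge S e)
  H-edge⇒G-edge {suc u} {suc w} e = ∧-conicalˡ (adj G u w) _ e

  φ₁ : Fin (size G) → Fin (size H)
  φ₁ u with u ≟ v
  ... | yes _ = zero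
  ... | no _  = suc u

  f∘φ₁ : ∀ u → f (φ₁ u) ≡ u
  f∘φ₁ u with u ≟ v
  ... | yes u≡v = sym u≡v
  ... | no _    = refl

  φ₁-v : φ₁ v ≡ zero
  φ₁-v with v ≟ v
  ... | yes _  = refl
  ... | no v≢v = ⊥-elim (v≢v refl)

  φ₁-≢ : ∀ {u} → u ≢ v → φ₁ u ≡ suc u
  φ₁-≢ {u} u≢v with u ≟ v
  ... | yes u≡v = ⊥-elim (u≢v u≡v)
  ... | no _    = refl

  lift-S : ∀ {a b} → containsEdge S a b ≡ true → Edge H (φ₁ a) (φ₁ b)
  lift-S {a} {b} sp with a ≟ v | b ≟ v
  ... | yes refl | yes refl = ⊥-elim (no-loop {G} (containsEdge⇒Edge S sp))
  ... | yes refl | no b≢v = sp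
  ... | no a≢v   | yes refl = trans (spoke-sym (centre S) (leaves S) v a) sp
  ... | no a≢v   | no b≢v rewrite ≟-≢ a≢v | ≟-≢ b≢v =
    trans (∧-identityʳ (adj G a b)) (containsEdge⇒Edge S sp)

  lift-other : ∀ {T a b} → T ∈ₗ A ++ B → containsEdge T a b ≡ true → Edge H (suc a) (suc b)
  lift-other {T} {a} {b} T∈ sp
    rewrite containsEdge⇒Edge T sp | exclusive T∈ sp | ∧-zeroʳ (⌊ a ≟ v ⌋ ∨ ⌊ b ≟ v ⌋) = refl

  noIsolated-H : NoIsolated G → NoIsolated H
  noIsolated-H _ zero with occurs⇒containsEdge S v∈S
  ... | w , sp = φ₁ w , subst (λ x → Edge H x (φ₁ w)) φ₁-v (lift-S sp)
  noIsolated-H noIsolatedG (suc u) with u ≟ v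
  ... | yes refl with find v∈AB
  ...   | T , T∈ , occT = let w , sp = occurs⇒containsEdge T occT in suc w , lift-other T∈ sp
  noIsolated-H noIsolatedG (suc u) | no u≢v with noIsolatedG u
  ...   | w , e with find (decomposition⇒cover dec u w e)
  ...     | T , T∈ , sp with ∈-++⁻ A T∈
  ...       | inj₁ T∈A         = suc w , lift-other (∈-++⁺ˡ T∈A) sp
  ...       | inj₂ (here refl) = φ₁ w , subst (λ x → Edge H x (φ₁ w)) (φ₁-≢ u≢v) (lift-S sp)
  ...       | inj₂ (there T∈B) = suc w , lift-other (∈-++⁺ʳ A T∈B) sp

  flip-edge : ∀ x y → Edge H x y → Edge H y x
  flip-edge x y e = trans (Graph.sym H y x) e

  no-edge-at-v₂ : ∀ {w} → containsEdge S v w ≡ true → adjH (suc v) (suc w) ≡ false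
  no-edge-at-v₂ {w} sp rewrite ≟-refl v | sp = ∧-zeroʳ (adj G v w)

  range-S : ∀ {x y} → Edge H x y → containsEdge S (f x) (f y) ≡ true → φ₁ (f x) ≡ x
  range-S {zero}            _ _  = φ₁-v
  range-S {suc u}           _ _  with u ≟ v
  ... | no _ = refl
  range-S {suc u} {zero}  _ sp | yes refl = ⊥-elim (no-loop {G} (containsEdge⇒Edge S sp))
  range-S {suc u} {suc w} e sp | yes refl with trans (sym e) (no-edge-at-v₂ sp)
  ... | ()

  range-other : ∀ {T x y} → T ∈ₗ A ++ B → Edge H x y →
    containsEdge T (f x) (f y) ≡ true → suc (f x) ≡ x
  range-other {x = suc u} _ _ _ = refl
  range-other {x = zero} {suc w} T∈ e sp with trans (sym e) (exclusive T∈ sp)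
  ... | ()

  ends-in-range : ∀ (T : StarSub G) (φ : Fin (size G) → Fin (size H)) →
    (∀ {x y} → Edge H x y → containsEdge T (f x) (f y) ≡ true → φ (f x) ≡ x) →
    ∀ {x y} → Edge H x y → containsEdge T (f x) (f y) ≡ true → φ (f x) ≡ x × φ (f y) ≡ y
  ends-in-range T φ range {x} {y} e sp =
    range e sp , range {y} {x} (flip-edge x y e) (trans (spoke-sym (centre T) (leaves T) (f y) (f x)) sp)

  push↑ push₁ : StarSub G → List (StarSub H)
  push↑ = push suc
  push₁ = push φ₁

  𝒫′ : List (StarSub H)
  𝒫′ = concatMap (push↑) A ++ push₁ S ++ concatMap (push↑) B

  decomposition : IsStarDecomposition H 𝒫′
  decomposition x y e = begin
    tally P 𝒫′
      ≡⟨ tally-++ P (concatMap (push↑) A) _ ⟩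
    tally P (concatMap (push↑) A) + tally P (push₁ S ++ concatMap (push↑) B)
      ≡⟨ cong (tally P (concatMap (push↑) A) +_) (tally-++ P (push₁ S) _) ⟩
    tally P (concatMap (push↑) A) + (tally P (push₁ S) + tally P (concatMap (push↑) B))
      ≡⟨ cong₂ _+_ (tally-concatMap P (push↑) A (pushed-other ∘ ∈-++⁺ˡ))
           (cong₂ _+_ (tally-push {H = H} φ₁ f f∘φ₁ S e (ends-in-range S φ₁ range-S e))
                      (tally-concatMap P (push↑) B (pushed-other ∘ ∈-++⁺ʳ A))) ⟩
    tally Q A + (indicator (Q S) + tally Q B)
      ≡⟨ sym (tally-++ Q A (S ∷ B)) ⟩
    tally Q (A ++ S ∷ B)
      ≡⟨ dec (f x) (f y) (H-edge⇒G-edge {x} {y} e) ⟩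
    1 ∎
    where
    open ≡-Reasoning
    P : StarSub H → Bool
    P R = containsEdge R x y
    Q : StarSub G → Bool
    Q T = containsEdge T (f x) (f y)
    pushed-other : ∀ {T} → T ∈ₗ A ++ B → tally P (push↑ T) ≡ indicator (Q T)
    pushed-other {T} T∈ = tally-push {H = H} suc f (λ _ → refl) T e (ends-in-range T suc (range-other T∈) e)

  wgt-𝒫′ : wgt 𝒫′ ≤ wgt (A ++ S ∷ B)
  wgt-𝒫′ = begin
    wgt 𝒫′
      ≡⟨ wgt-++ (concatMap (push↑) A) _ ⟩
    wgt (concatMap (push↑) A) + wgt (push₁ S ++ concatMap (push↑) B)
      ≡⟨ cong (wgt (concatMap (push↑) A) +_) (wgt-++ (push₁ S) _) ⟩
    wgt (concatMap (push↑) A) + (wgt (push₁ S) + wgt (concatMap (push↑) B))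
      ≤⟨ +-mono-≤ (wgt-concatMap (push↑) (wgt-push {H = H} suc) A)
                  (+-mono-≤ (wgt-push {H = H} φ₁ S) (wgt-concatMap (push↑) (wgt-push {H = H} suc) B)) ⟩
    wgt A + (suc ∣ leaves S ∣ + wgt B)
      ≡⟨ sym (wgt-++ A (S ∷ B)) ⟩
    wgt (A ++ S ∷ B) ∎
    where open ≤-Reasoning

constellation-or-split : ∀ {G} 𝒫 → NoIsolated G → IsStarDecomposition G 𝒫 →
  IsConstellation G ⊎
  (Σ Graph λ H → InclusiveSplit G H × size G < size H × NoIsolated H ×
     Σ (List (StarSub H)) λ 𝒬 → IsStarDecomposition H 𝒬 × wgt 𝒬 ≤ wgt 𝒫)
constellation-or-split {G} 𝒫 noIsolated dec with all? (λ x → multiplicity 𝒫 x ≤? 1)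
... | yes ≤1 = inj₁ (Disjoint.constellation 𝒫 dec (decomposition-occurs 𝒫 noIsolated dec) ≤1)
... | no ¬≤1 with ¬∀⟶∃¬ (size G) _ (λ x → multiplicity 𝒫 x ≤? 1) ¬≤1
...   | v , ≰1 with 2≤tally⇒split (λ S → occurs S v) 𝒫 (≰⇒> ≰1)
...     | A , B , S , refl , v∈S , v∈AB =
  inj₂ (H , split , ≤-refl , noIsolated-H noIsolated , 𝒫′ , decomposition , wgt-𝒫′)
  where open SplitAt A S B v dec v∈S v∈AB

decomposition⇒splitSeq : ∀ k {G} 𝒫 → NoIsolated G → IsStarDecomposition G 𝒫 →
  wgt 𝒫 ≤ size G + k →
  ∃ λ K → ∃ λ j → j ≤ k × SplitSeq G K j × IsConstellation K
decomposition⇒splitSeq k 𝒫 noIsolated dec w with constellation-or-split 𝒫 noIsolated dec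
... | inj₁ isC = _ , 0 , z≤n , done , isC
decomposition⇒splitSeq zero {G} 𝒫 _ _ w | inj₂ (H , _ , G<H , noIsolatedH , 𝒬 , decH , w𝒬) =
  ⊥-elim (1+n≰n (begin
    suc (size G) ≤⟨ G<H ⟩
    size H       ≤⟨ size≤wgt (decomposition-occurs 𝒬 noIsolatedH decH) ⟩
    wgt 𝒬        ≤⟨ w𝒬 ⟩
    wgt 𝒫        ≤⟨ w ⟩
    size G + 0   ≡⟨ +-identityʳ (size G) ⟩
    size G       ∎))
  where open ≤-Reasoning
decomposition⇒splitSeq (suc k) {G} 𝒫 _ _ w | inj₂ (H , split , G<H , noIsolatedH , 𝒬 , decH , w𝒬)
  with decomposition⇒splitSeq k 𝒬 noIsolatedH decH (begin
    wgt 𝒬            ≤⟨ w𝒬 ⟩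
    wgt 𝒫            ≤⟨ w ⟩
    size G + suc k   ≡⟨ +-suc (size G) k ⟩
    suc (size G) + k ≤⟨ +-monoˡ-≤ k G<H ⟩
    size H + k       ∎)
  where open ≤-Reasoning
... | K , j , j≤k , seq , isC = K , suc j , s≤s j≤k , step split seq , isC

theorem2 : (G : Graph) → NoIsolated G → (k : ℕ) → NonZero k →
    (∃ λ H → ∃ λ j → j ≤ k × SplitSeq G H j × IsConstellation H) ⇔
    (Σ (List (StarSub G)) λ 𝒫 → IsStarDecomposition G 𝒫 × wgt 𝒫 ≤ size G + k)
theorem2 G noIsolated k _ = mk⇔ splits⇒decomposition decomposition⇒splits
  where
  splits⇒decomposition : (∃ λ H → ∃ λ j → j ≤ k × SplitSeq G H j × IsConstellation H) →
    Σ (List (StarSub G)) λ 𝒫 → IsStarDecomposition G 𝒫 × wgt 𝒫 ≤ size G + k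
  splits⇒decomposition (_ , j , j≤k , seq , isC) with splitSeq⇒starCover seq isC
  ... | 𝒫 , cover , w =
    dedup 𝒫 , starCover⇒decomposition cover ,
    ≤-trans (wgt-dedup 𝒫) (≤-trans w (+-monoʳ-≤ (size G) j≤k))

  decomposition⇒splits :
    (Σ (List (StarSub G)) λ 𝒫 → IsStarDecomposition G 𝒫 × wgt 𝒫 ≤ size G + k) →
    ∃ λ H → ∃ λ j → j ≤ k × SplitSeq G H j × IsConstellation H
  decomposition⇒splits (𝒫 , dec , w) = decomposition⇒splitSeq k 𝒫 noIsolated dec w
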